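{- Let $H$ be a finite connected simple bipartite graph of maximum degree at most $3$ and minimum degree $2$, and let $G_R$ and $G'_S$ be its two rooted distance-two components. If the girth of $H$ is at least $6$, then there exists a valid decomposition $\mathcal{D}$ of $G_R$ such that the rooted graphs $G'_S$ and $I(\mathcal{D})_{\mathcal{D}_{\sharp2}}$ are isomorphic (by an isomorphism mapping roots to roots), and $H$ is isomorphic to the incidence graph of $\mathcal{D}$.
   Context: The distance-two multigraph of $H$ is the multigraph on $V(H)$ where the multiplicity between distinct $u,v$ is the number of paths of length $2$ between them in $H$. A rooted distance-two component of $H$ is the sub-multigraph induced on the vertex set of a connected component of the distance-two multigraph, with roots the vertices of degree $2$ in $H$. A valid decomposition $\mathcal{D}$ of a rooted graph $G_R$ ($G$ simple) is a partition of $E(G)$ into parts each of which is a triangle or a single edge, each part identified with its vertex set ($3$- or $2$-element set), such that every vertex of $G$ belongs to exactly $3$ parts, except that each root belongs to exactly $2$ parts. $\mathcal{D}_{\sharp2}$ is the set of edge (two-element) parts. The intersection graph $I(\mathcal{D})$ has vertex set $\mathcal{D}$, two parts adjacent iff they intersect; $I(\mathcal{D})_{\mathcal{D}_{\sharp2}}$ is this graph with root set $\mathcal{D}_{\sharp2}$. The incidence graph of $\mathcal{D}$ is the bipartite graph with parts $\bigcup\mathcal{D}$ and $\mathcal{D}$, with $a\sim\alpha$ iff $a\in\alpha$. -}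

module Defs where

open import Data.Nat using (ℕ; zero; suc; _+_; _≤_; _<_)
open import Data.Bool using (Bool; true; false; T; _∧_; _∨_; not; if_then_else_)
open import Data.Fin using (Fin; zero; suc; inject₁; fromℕ; _≟_)
open import Data.Product using (Σ; ∃; _×_; _,_; proj₁)
open import Data.Sum using (_⊎_; inj₁; inj₂)
open import Data.Empty using (⊥)
open import Function using (_∘_)
open import Function.Bundles using (_↔_; Inverse)
open import Relation.Nullary using (¬_)
open import Relation.Nullary.Decidable using (⌊_⌋)
open import Relation.Binary.PropositionalEquality using (_≡_; _≢_)
open import Relation.Binary.Construct.Closure.ReflexiveTransitive using (Star)

count : ∀ {k} → (Fin k → Bool) → ℕ
count {zero}  P = 0
count {suc k} P = (if P zero then 1 else 0) + count (P ∘ suc)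

anyFin : ∀ {k} → (Fin k → Bool) → Bool
anyFin {zero}  P = false
anyFin {suc k} P = P zero ∨ anyFin (P ∘ suc)

record Graph : Set where
  field
    n      : ℕ
    adj    : Fin n → Fin n → Bool
    sym    : ∀ u v → adj u v ≡ adj v u
    irrefl : ∀ v → adj v v ≡ false
  V : Set
  V = Fin n

module _ (H : Graph) where
  open Graph H

  Adj : Fin n → Fin n → Set
  Adj u v = T (adj u v)

  deg : Fin n → ℕ
  deg v = count (adj v)

  Connected : Set
  Connected = ∀ u v → Star Adj u v

  Bipartite : Set
  Bipartite = Σ (Fin n → Bool) λ c → ∀ u v → Adj u v → c u ≢ c v

  MaxDegreeAtMost3 : Set
  MaxDegreeAtMost3 = ∀ v → deg v ≤ 3

  MinDegree2 : Set
  MinDegree2 = (∀ v → 2 ≤ deg v) × ∃ λ v → deg v ≡ 2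

  HasCycleOfLength : ℕ → Set
  HasCycleOfLength zero    = ⊥
  HasCycleOfLength (suc m) =
    Σ (Fin (suc m) → Fin n) λ f →
      (∀ i j → f i ≡ f j → i ≡ j) ×
      (∀ (i : Fin m) → Adj (f (inject₁ i)) (f (suc i))) ×
      Adj (f (fromℕ m)) (f zero)

  -- girth ≥ 6 : no cycle of length 3, 4 or 5 (an acyclic graph has girth ∞)
  GirthAtLeast6 : Set
  GirthAtLeast6 = ∀ k → 3 ≤ k → k < 6 → ¬ HasCycleOfLength k

  -- Distance-two multigraph: multiplicity = number of paths u - w - v

  mult : Fin n → Fin n → ℕ
  mult u v = count (λ w → adj u w ∧ adj w v)

  D2Adj : Fin n → Fin n → Set
  D2Adj u v = u ≢ v × 0 < mult u v

  VSet : Set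
  VSet = Fin n → Bool

  IsD2Component : VSet → Set
  IsD2Component C =
    (∃ λ v → T (C v)) ×
    (∀ u v → T (C u) → D2Adj u v → T (C v)) ×
    (∀ u v → T (C u) → T (C v) → Star D2Adj u v)

  IsRoot : Fin n → Set
  IsRoot v = deg v ≡ 2

  record Decomposition (C : VSet) : Set where
    field
      k    : ℕ
      part : Fin k → VSet

    partsAt : Fin n → ℕ
    partsAt v = count (λ i → part i v)

    partsAt₂ : Fin n → Fin n → ℕ
    partsAt₂ u v = count (λ i → part i u ∧ part i v)

    size : Fin k → ℕ
    size i = count (part i)

    IsEdgePart : Fin k → Set
    IsEdgePart i = size i ≡ 2

    -- intersection graph I(𝒟), as a 0/1 multiplicity
    Imult : Fin k → Fin k → ℕ
    Imult i j =
      if not ⌊ i ≟ j ⌋ ∧ anyFin (λ v → part i v ∧ part j v) then 1 else 0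

    inUnion : Fin n → Bool
    inUnion v = anyFin (λ i → part i v)

    IncVertex : Set
    IncVertex = Σ (Fin n) (λ v → T (inUnion v)) ⊎ Fin k

    incAdj : IncVertex → IncVertex → Bool
    incAdj (inj₁ (a , _)) (inj₂ α) = part α a
    incAdj (inj₂ α) (inj₁ (a , _)) = part α a
    incAdj _ _ = false

  IsValidDecomposition : (C : VSet) → Decomposition C → Set
  IsValidDecomposition C D =
    (∀ u v → T (C u) → T (C v) → u ≢ v → mult u v ≤ 1) ×
    (∀ i → size i ≡ 2 ⊎ size i ≡ 3) ×
    (∀ i v → T (part i v) → T (C v)) ×
    -- the parts partition E(G) into single edges and triangles of G
    (∀ u v → T (C u) → T (C v) → u ≢ v → partsAt₂ u v ≡ mult u v) ×
    (∀ v → T (C v) → IsRoot v → partsAt v ≡ 2) ×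
    (∀ v → T (C v) → ¬ IsRoot v → partsAt v ≡ 3)
    where open Decomposition D

  RootedIsoToIntersection : (C' C : VSet) → Decomposition C → Set
  RootedIsoToIntersection C' C D =
    Σ (Σ (Fin n) (λ v → T (C' v)) ↔ Fin k) λ φ →
      (∀ x y → proj₁ x ≢ proj₁ y →
         mult (proj₁ x) (proj₁ y) ≡ Imult (Inverse.to φ x) (Inverse.to φ y)) ×
      (∀ x → (IsRoot (proj₁ x) → IsEdgePart (Inverse.to φ x)) ×
             (IsEdgePart (Inverse.to φ x) → IsRoot (proj₁ x)))
    where open Decomposition D

  IsoToIncidence : (C : VSet) → Decomposition C → Set
  IsoToIncidence C D =
    Σ (Fin n ↔ IncVertex) λ ψ →
      ∀ u v → adj u v ≡ incAdj (Inverse.to ψ u) (Inverse.to ψ v)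
    where open Decomposition D

{-# OPTIONS --safe #-}
module Submission where

-- Distance two preserves the colour of a bipartite graph, and by connectivity every vertex lies
-- in one of the two components or has all its neighbours in it; hence C and C′ are exactly the
-- two colour classes of H. Take as parts the neighbourhoods N(w) ⊆ C of the vertices w ∈ C′.
-- A vertex v ∈ C lies in deg v parts, two vertices of C lie in mult of them, and N(w) has deg w
-- elements, so the roots of C′ are exactly the centres of edge parts. Girth at least 6 excludes
-- 4-cycles, so the distance-two multigraph is simple and N(w), N(w′) meet exactly when w, w′ are
-- adjacent in it. H is the incidence graph of the parts, with C as points and C′ as parts.

open import Defs
open import Data.Bool using (Bool; true; false; T; _∧_; not; if_then_else_)
open import Data.Bool.Properties using (T-irrelevant; T-∧; T-∨; T-≡; ¬-not; T?)
open import Data.Nat using (ℕ; zero; suc; _≤_; _<_; z≤n; s≤s)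
open import Data.Nat.Properties using (≤-antisym; ≤-trans; ≤-pred; ≰⇒>; n≤1+n; m<n⇒0<n; m≤n⇒m<n∨m≡n; m<1+n⇒m≤n)
open import Data.Fin using (Fin; zero; suc; inject₁; fromℕ<; _≟_)
open import Data.Fin.Properties using (+↔⊎; 0↔⊥; 1↔⊤; toℕ<n; 0≢1+n)
open import Data.Fin.Patterns using (0F; 1F; 2F; 3F)
open import Data.Fin.Permutation using (↔⇒≡)
open import Data.Product using (Σ; ∃; ∃₂; _×_; _,_; proj₁; proj₂)
open import Data.Product.Function.Dependent.Propositional using (Σ-↔)
open import Data.Sum using (_⊎_; inj₁; inj₂; [_,_]′)
open import Data.Sum.Function.Propositional using (_⊎-↔_)
open import Data.Empty using (⊥-elim)
open import Data.Unit using ()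
open import Function using (_∘_; id)
open import Function.Bundles using (_↔_; Inverse; Injection; mk↔ₛ′; Equivalence)
open import Function.Properties.Inverse using (↔-refl; ↔-trans; ↔-sym; ↔⇒↣)
open import Relation.Nullary using (¬_; yes; no)
open import Relation.Nullary.Decidable using (dec-false; isYes≗does)
open import Relation.Binary.PropositionalEquality
open import Relation.Binary.Construct.Closure.ReflexiveTransitive using (Star; ε; _◅_)

open Inverse using (to; from)

private
  variable
    n m k : ℕ

Σ-T-≡ : {A : Set} {P : A → Bool} {x y : Σ A (T ∘ P)} → proj₁ x ≡ proj₁ y → x ≡ y
Σ-T-≡ {x = a , p} {.a , q} refl = cong (a ,_) (T-irrelevant p q)

module _ {A : Set} {P Q : A → Bool} where

  Σ-T-cong : (∀ a → T (P a) → T (Q a)) → (∀ a → T (Q a) → T (P a)) →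
             Σ A (T ∘ P) ↔ Σ A (T ∘ Q)
  Σ-T-cong P⇒Q Q⇒P = mk↔ₛ′ (λ (a , p) → a , P⇒Q a p) (λ (a , q) → a , Q⇒P a q)
    (λ _ → Σ-T-≡ {P = Q} refl) (λ _ → Σ-T-≡ refl)

  Σ-T-restrict : (∀ a → T (Q a) → T (P a)) → Σ (Σ A (T ∘ P)) (T ∘ Q ∘ proj₁) ↔ Σ A (T ∘ Q)
  Σ-T-restrict Q⇒P = mk↔ₛ′ (λ ((a , _) , q) → a , q) (λ (a , q) → (a , Q⇒P a q) , q)
    (λ _ → refl) (λ ((a , p) , q) → cong (λ p′ → (a , p′) , q) (T-irrelevant _ _))

  partition-↔ : (cover : ∀ a → T (P a) ⊎ T (Q a)) → (∀ a → ¬ (T (P a) × T (Q a))) →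
                A ↔ (Σ A (T ∘ P) ⊎ Σ A (T ∘ Q))
  partition-↔ cover disjoint = mk↔ₛ′ split merge split∘merge merge∘split
    where
    split : A → Σ A (T ∘ P) ⊎ Σ A (T ∘ Q)
    split a = [ inj₁ ∘ (a ,_) , inj₂ ∘ (a ,_) ]′ (cover a)
    merge : Σ A (T ∘ P) ⊎ Σ A (T ∘ Q) → A
    merge = [ proj₁ , proj₁ ]′
    split∘merge : ∀ x → split (merge x) ≡ x
    split∘merge (inj₁ (a , p)) with cover a
    ... | inj₁ _ = cong inj₁ (Σ-T-≡ refl)
    ... | inj₂ q = ⊥-elim (disjoint a (p , q))
    split∘merge (inj₂ (a , q)) with cover a
    ... | inj₁ p = ⊥-elim (disjoint a (p , q))
    ... | inj₂ _ = cong inj₂ (Σ-T-≡ refl)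
    merge∘split : ∀ a → merge (split a) ≡ a
    merge∘split a with cover a
    ... | inj₁ _ = refl
    ... | inj₂ _ = refl

T↔Fin : ∀ b → T b ↔ Fin (if b then 1 else 0)
T↔Fin true  = ↔-sym 1↔⊤
T↔Fin false = ↔-sym 0↔⊥

Σ-Fin-suc : (P : Fin (suc n) → Bool) →
            Σ (Fin (suc n)) (T ∘ P) ↔ (T (P zero) ⊎ Σ (Fin n) (T ∘ P ∘ suc))
Σ-Fin-suc P = mk↔ₛ′ split merge split∘merge merge∘split
  where
  split : Σ _ (T ∘ P) → _
  split (zero  , p) = inj₁ p
  split (suc i , p) = inj₂ (i , p)
  merge : _ → Σ _ (T ∘ P)
  merge (inj₁ p)       = zero , p
  merge (inj₂ (i , p)) = suc i , p
  split∘merge : ∀ x → split (merge x) ≡ x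
  split∘merge (inj₁ _) = refl
  split∘merge (inj₂ _) = refl
  merge∘split : ∀ x → merge (split x) ≡ x
  merge∘split (zero  , _) = refl
  merge∘split (suc _ , _) = refl

enumerate : (P : Fin n → Bool) → Σ (Fin n) (T ∘ P) ↔ Fin (count P)
enumerate {zero}  P = mk↔ₛ′ (λ ()) (λ ()) (λ ()) (λ ())
enumerate {suc n} P =
  ↔-trans (Σ-Fin-suc P) (↔-trans (T↔Fin (P zero) ⊎-↔ enumerate (P ∘ suc)) (↔-sym +↔⊎))

count-cong-↔ : {P : Fin n → Bool} {Q : Fin m → Bool} →
               Σ (Fin n) (T ∘ P) ↔ Σ (Fin m) (T ∘ Q) → count P ≡ count Q
count-cong-↔ {P = P} {Q} ψ = ↔⇒≡ (↔-trans (↔-sym (enumerate P)) (↔-trans ψ (enumerate Q)))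

count-cong : {P Q : Fin n → Bool} → (∀ i → P i ≡ Q i) → count P ≡ count Q
count-cong P≡Q = count-cong-↔ (Σ-T-cong (λ i → subst T (P≡Q i)) (λ i → subst T (sym (P≡Q i))))

count-reindex : {P Q : Fin n → Bool} (φ : Σ (Fin n) (T ∘ P) ↔ Fin k) →
                (∀ i → T (Q i) → T (P i)) → count (Q ∘ proj₁ ∘ from φ) ≡ count Q
count-reindex φ Q⇒P = count-cong-↔ (↔-trans (Σ-↔ (↔-sym φ) ↔-refl) (Σ-T-restrict Q⇒P))

count>0⇒∃ : (P : Fin n → Bool) → 0 < count P → ∃ (T ∘ P)
count>0⇒∃ P count>0 = from (enumerate P) (fromℕ< count>0)

∃⇒count>0 : (P : Fin n → Bool) {i : Fin n} → T (P i) → 0 < count P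
∃⇒count>0 P {i} p = m<n⇒0<n (toℕ<n (to (enumerate P) (i , p)))

count≥2⇒∃₂ : (P : Fin n → Bool) → 2 ≤ count P → ∃₂ λ i j → i ≢ j × T (P i) × T (P j)
count≥2⇒∃₂ {n} P = two (enumerate P)
  where
  two : Σ (Fin n) (T ∘ P) ↔ Fin m → 2 ≤ m → ∃₂ λ i j → i ≢ j × T (P i) × T (P j)
  two {suc zero} φ (s≤s ())
  two {suc (suc _)} φ _ = let (i , p) = from φ zero ; (j , q) = from φ (suc zero) in
    i , j , (λ i≡j → 0≢1+n (Injection.injective (↔⇒↣ (↔-sym φ)) (Σ-T-≡ i≡j))) , p , q

∃⇒anyFin : (P : Fin n → Bool) (i : Fin n) → T (P i) → T (anyFin P)
∃⇒anyFin P zero    p = Equivalence.from T-∨ (inj₁ p)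
∃⇒anyFin P (suc i) p = Equivalence.from T-∨ (inj₂ (∃⇒anyFin (P ∘ suc) i p))

anyFin⇒∃ : (P : Fin n → Bool) → T (anyFin P) → ∃ (T ∘ P)
anyFin⇒∃ {suc n} P any with P zero in P0
... | true  = zero , Equivalence.from T-≡ P0
... | false = let (i , p) = anyFin⇒∃ (P ∘ suc) any in suc i , p

anyFin≡false⇒count≡0 : (P : Fin n → Bool) → anyFin P ≡ false → count P ≡ 0
anyFin≡false⇒count≡0 {zero}  P _ = refl
anyFin≡false⇒count≡0 {suc n} P none with P zero
... | false = anyFin≡false⇒count≡0 (P ∘ suc) none

count≤1⇒count≡anyFin : (P : Fin n → Bool) → count P ≤ 1 → count P ≡ (if anyFin P then 1 else 0)
count≤1⇒count≡anyFin P count≤1 with anyFin P in any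
... | true  = ≤-antisym count≤1 (∃⇒count>0 P (proj₂ (anyFin⇒∃ P (Equivalence.from T-≡ any))))
... | false = anyFin≡false⇒count≡0 P any

module _ (H : Graph) where
  open Graph H using (V; adj; irrefl) renaming (sym to adj-sym)

  private
    variable
      u v w : V

  Adj⇒≢ : Adj H u v → u ≢ v
  Adj⇒≢ {u} p refl = subst T (irrefl u) p

  Adj-sym : Adj H u v → Adj H v u
  Adj-sym {u} {v} = subst T (adj-sym u v)

  path₂⇒mult>0 : Adj H u w → Adj H w v → 0 < mult H u v
  path₂⇒mult>0 {u} {w} {v} uw wv = ∃⇒count>0 (λ x → adj u x ∧ adj x v) (Equivalence.from T-∧ (uw , wv))

  mult>0⇒path₂ : 0 < mult H u v → ∃ λ w → Adj H u w × Adj H w v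
  mult>0⇒path₂ {u} {v} mult>0 =
    let (w , p) = count>0⇒∃ (λ x → adj u x ∧ adj x v) mult>0 in w , Equivalence.to T-∧ p

  square⇒C4 : ∀ {u w v w′} → u ≢ v → w ≢ w′ →
              Adj H u w → Adj H w v → Adj H v w′ → Adj H w′ u → HasCycleOfLength H 4
  square⇒C4 {u} {w} {v} {w′} u≢v w≢w′ uw wv vw′ w′u = f , injective , steps , w′u
    where
    f : Fin 4 → V
    f 0F = u
    f 1F = w
    f 2F = v
    f 3F = w′
    injective : ∀ i j → f i ≡ f j → i ≡ j
    injective 0F 0F _ = refl
    injective 0F 1F e = ⊥-elim (Adj⇒≢ uw e)
    injective 0F 2F e = ⊥-elim (u≢v e)
    injective 0F 3F e = ⊥-elim (Adj⇒≢ w′u (sym e))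
    injective 1F 0F e = ⊥-elim (Adj⇒≢ uw (sym e))
    injective 1F 1F _ = refl
    injective 1F 2F e = ⊥-elim (Adj⇒≢ wv e)
    injective 1F 3F e = ⊥-elim (w≢w′ e)
    injective 2F 0F e = ⊥-elim (u≢v (sym e))
    injective 2F 1F e = ⊥-elim (Adj⇒≢ wv (sym e))
    injective 2F 2F _ = refl
    injective 2F 3F e = ⊥-elim (Adj⇒≢ vw′ e)
    injective 3F 0F e = ⊥-elim (Adj⇒≢ w′u e)
    injective 3F 1F e = ⊥-elim (w≢w′ (sym e))
    injective 3F 2F e = ⊥-elim (Adj⇒≢ vw′ (sym e))
    injective 3F 3F _ = refl
    steps : ∀ (i : Fin 3) → Adj H (f (inject₁ i)) (f (suc i))
    steps 0F = uw
    steps 1F = wv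
    steps 2F = vw′

  ¬C4⇒mult≤1 : ¬ HasCycleOfLength H 4 → u ≢ v → mult H u v ≤ 1
  ¬C4⇒mult≤1 {u} {v} noC4 u≢v = ≤-pred (≰⇒> λ mult≥2 →
    let (w , w′ , w≢w′ , p , p′) = count≥2⇒∃₂ (λ x → adj u x ∧ adj x v) mult≥2
        (uw , wv) = Equivalence.to T-∧ p
        (uw′ , w′v) = Equivalence.to T-∧ p′
    in noC4 (square⇒C4 u≢v w≢w′ uw wv (Adj-sym w′v) (Adj-sym uw′)))

  mult>0⇒same-colour : ((colour , _) : Bipartite H) → 0 < mult H u v → colour u ≡ colour v
  mult>0⇒same-colour (colour , proper) mult>0 =
    let (w , uw , wv) = mult>0⇒path₂ mult>0
    in trans (¬-not (proper _ _ uw)) (sym (¬-not (≢-sym (proper _ _ wv))))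

  D2Component⇒independent : ∀ {K} → Bipartite H → IsD2Component H K →
                            T (K u) → T (K v) → ¬ Adj H u v
  D2Component⇒independent bip@(colour , proper) (_ , _ , K-connected) Ku Kv uv =
    proper _ _ uv (same-colour (K-connected _ _ Ku Kv))
    where
    same-colour : ∀ {x y} → Star (D2Adj H) x y → colour x ≡ colour y
    same-colour ε                  = refl
    same-colour ((_ , mult>0) ◅ s) = trans (mult>0⇒same-colour bip mult>0) (same-colour s)

  D2Component-absorbs : ∀ {K} → Connected H → IsD2Component H K →
                        ∀ v → T (K v) ⊎ (∀ {w} → Adj H v w → T (K w))
  D2Component-absorbs {K} connected ((v₀ , Kv₀) , K-closed , _) v = walk (inj₁ Kv₀) (connected v₀ v)
    where
    Absorbed : V → Set
    Absorbed x = T (K x) ⊎ (∀ {w} → Adj H x w → T (K w))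
    path₂-closed : ∀ {x y z} → T (K x) → Adj H x y → Adj H y z → T (K z)
    path₂-closed {x} {z = z} Kx xy yz with x ≟ z
    ... | yes refl = Kx
    ... | no  x≢z  = K-closed x z Kx (x≢z , path₂⇒mult>0 xy yz)
    step : ∀ {x y} → Absorbed x → Adj H x y → Absorbed y
    step (inj₁ Kx)   xy = inj₂ (path₂-closed Kx xy)
    step (inj₂ N⊆K) xy = inj₁ (N⊆K xy)
    walk : ∀ {x y} → Absorbed x → Star (Adj H) x y → Absorbed y
    walk a ε        = a
    walk a (xy ◅ s) = walk (step a xy) s

  record Bipartition (C C′ : VSet H) : Set where
    field
      cover          : ∀ v → T (C v) ⊎ T (C′ v)
      disjoint       : ∀ v → ¬ (T (C v) × T (C′ v))
      C-independent  : T (C u) → T (C v) → ¬ Adj H u v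
      C′-independent : T (C′ u) → T (C′ v) → ¬ Adj H u v

    C⇒N⊆C′ : T (C u) → Adj H u v → T (C′ v)
    C⇒N⊆C′ {v = v} Cu uv = [ (λ Cv → ⊥-elim (C-independent Cu Cv uv)) , id ]′ (cover v)

    C′⇒N⊆C : T (C′ u) → Adj H u v → T (C v)
    C′⇒N⊆C {v = v} C′u uv = [ id , (λ C′v → ⊥-elim (C′-independent C′u C′v uv)) ]′ (cover v)

  D2Components⇒bipartition : ∀ {C C′} → Connected H → Bipartite H → (∀ v → ∃ (Adj H v)) →
                             IsD2Component H C → IsD2Component H C′ →
                             (∀ v → ¬ (T (C v) × T (C′ v))) → Bipartition C C′
  D2Components⇒bipartition connected bip neighbour compC compC′ disjoint = record
    { cover          = cover
    ; disjoint       = disjoint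
    ; C-independent  = D2Component⇒independent bip compC
    ; C′-independent = D2Component⇒independent bip compC′
    }
    where
    cover : ∀ v → _
    cover v with D2Component-absorbs connected compC v | D2Component-absorbs connected compC′ v
    ... | inj₁ Cv   | _          = inj₁ Cv
    ... | inj₂ _    | inj₁ C′v   = inj₂ C′v
    ... | inj₂ N⊆C | inj₂ N⊆C′ = let (w , vw) = neighbour v in ⊥-elim (disjoint w (N⊆C vw , N⊆C′ vw))

  module NeighbourhoodDecomposition {C C′ : VSet H} (B : Bipartition C C′) where
    open Bipartition B

    φ : Σ (V) (T ∘ C′) ↔ Fin (count C′)
    φ = enumerate C′

    centre : Fin (count C′) → V
    centre = proj₁ ∘ from φ

    𝒟 : Decomposition H C
    𝒟 = record { k = count C′ ; part = adj ∘ centre }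

    open Decomposition 𝒟

    part-to : ∀ x w → part (to φ x) w ≡ adj (proj₁ x) w
    part-to x w = cong (λ z → adj (proj₁ z) w) (Inverse.strictlyInverseʳ φ x)

    part⇒C : ∀ i → T (part i v) → T (C v)
    part⇒C i = C′⇒N⊆C (proj₂ (from φ i))

    size-to : ∀ x → size (to φ x) ≡ deg H (proj₁ x)
    size-to x = count-cong (part-to x)

    partsAt≡deg : T (C v) → partsAt v ≡ deg H v
    partsAt≡deg {v} Cv = begin
      count (λ i → adj (centre i) v) ≡⟨ count-reindex φ (λ w wv → C⇒N⊆C′ Cv (Adj-sym wv)) ⟩
      count (λ w → adj w v)          ≡⟨ count-cong (λ w → adj-sym w v) ⟩
      deg H v                        ∎
      where open ≡-Reasoning

    partsAt₂≡mult : T (C u) → partsAt₂ u v ≡ mult H u v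
    partsAt₂≡mult {u} {v} Cu = begin
      count (λ i → adj (centre i) u ∧ adj (centre i) v)
        ≡⟨ count-reindex φ (λ w p → C⇒N⊆C′ Cu (Adj-sym (proj₁ (Equivalence.to T-∧ p)))) ⟩
      count (λ w → adj w u ∧ adj w v)
        ≡⟨ count-cong (λ w → cong (_∧ adj w v) (adj-sym w u)) ⟩
      mult H u v ∎
      where open ≡-Reasoning

    Imult≡anyFin : ∀ {i j} → i ≢ j → Imult i j ≡ (if anyFin (λ w → part i w ∧ part j w) then 1 else 0)
    Imult≡anyFin {i} {j} i≢j =
      cong (λ b → if not b ∧ anyFin (λ w → part i w ∧ part j w) then 1 else 0) (trans (isYes≗does (i ≟ j)) (dec-false (i ≟ j) i≢j))

    mult≡Imult : (∀ {u v} → u ≢ v → mult H u v ≤ 1) →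
                 ∀ x y → proj₁ x ≢ proj₁ y → mult H (proj₁ x) (proj₁ y) ≡ Imult (to φ x) (to φ y)
    mult≡Imult simple x@(a , _) y@(b , _) a≢b = begin
      mult H a b                  ≡⟨ mult≡countQ ⟩
      count Q                     ≡⟨ count≤1⇒count≡anyFin Q (subst (_≤ 1) mult≡countQ (simple a≢b)) ⟩
      (if anyFin Q then 1 else 0) ≡⟨ Imult≡anyFin i≢j ⟨
      Imult i j                   ∎
      where
      open ≡-Reasoning
      i = to φ x
      j = to φ y
      i≢j : i ≢ j
      i≢j = a≢b ∘ cong proj₁ ∘ Injection.injective (↔⇒↣ φ)
      Q : V → Bool
      Q w = part i w ∧ part j w
      mult≡countQ : mult H a b ≡ count Q
      mult≡countQ = count-cong λ w →
        sym (cong₂ _∧_ (part-to x w) (trans (part-to y w) (adj-sym b w)))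

    incidence : (∀ v → ∃ (Adj H v)) → IsoToIncidence H C 𝒟
    incidence neighbour = ψ , adj≡incAdj
      where
      C⇒inUnion : ∀ a → T (C a) → T (inUnion a)
      C⇒inUnion a Ca =
        let (w , aw) = neighbour a ; x = (w , C⇒N⊆C′ Ca aw)
        in ∃⇒anyFin (λ i → part i a) (to φ x) (subst T (sym (part-to x a)) (Adj-sym aw))
      inUnion⇒C : ∀ a → T (inUnion a) → T (C a)
      inUnion⇒C a t = let (i , p) = anyFin⇒∃ (λ i → part i a) t in part⇒C i p
      ψ : V ↔ IncVertex
      ψ = ↔-trans (partition-↔ cover disjoint) (Σ-T-cong C⇒inUnion inUnion⇒C ⊎-↔ φ)
      adj≡incAdj : ∀ u v → adj u v ≡ incAdj (to ψ u) (to ψ v)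
      -- Matching on `cover` also evaluates `to ψ`, whose first stage splits along `cover`.
      adj≡incAdj u v with cover u | cover v
      ... | inj₁ Cu  | inj₁ Cv  = dec-false (T? _) (C-independent Cu Cv)
      ... | inj₁ Cu  | inj₂ C′v = trans (adj-sym u v) (sym (part-to (v , C′v) u))
      ... | inj₂ C′u | inj₁ Cv  = sym (part-to (u , C′u) v)
      ... | inj₂ C′u | inj₂ C′v = dec-false (T? _) (C′-independent C′u C′v)

    valid : (∀ {u v} → u ≢ v → mult H u v ≤ 1) → (∀ v → deg H v ≡ 2 ⊎ deg H v ≡ 3) →
            IsValidDecomposition H C 𝒟
    valid simple deg∈2,3 =
        (λ _ _ _ _ → simple)
      , (λ i → deg∈2,3 (centre i))
      , (λ i _ → part⇒C i)
      , (λ _ _ Cu _ _ → partsAt₂≡mult Cu)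
      , (λ _ Cv root → trans (partsAt≡deg Cv) root)
      , (λ v Cv ¬root → trans (partsAt≡deg Cv) ([ ⊥-elim ∘ ¬root , id ]′ (deg∈2,3 v)))

    rooted : (∀ {u v} → u ≢ v → mult H u v ≤ 1) → RootedIsoToIntersection H C′ C 𝒟
    rooted simple = φ , mult≡Imult simple , λ x → trans (size-to x) , trans (sym (size-to x))

2≤m≤3⇒m≡2⊎m≡3 : 2 ≤ m → m ≤ 3 → m ≡ 2 ⊎ m ≡ 3
2≤m≤3⇒m≡2⊎m≡3 2≤m m≤3 = [ inj₁ ∘ sym ∘ ≤-antisym 2≤m ∘ m<1+n⇒m≤n , inj₂ ]′ (m≤n⇒m<n∨m≡n m≤3)

lemma4p2 : (H : Graph) → Connected H → Bipartite H → MaxDegreeAtMost3 H → MinDegree2 H →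
    (C C' : VSet H) → IsD2Component H C → IsD2Component H C' →
    (∀ v → ¬ (T (C v) × T (C' v))) →
    GirthAtLeast6 H →
    Σ (Decomposition H C) λ D →
      IsValidDecomposition H C D × RootedIsoToIntersection H C' C D × IsoToIncidence H C D
lemma4p2 H connected bipartite maxDeg minDeg C C′ compC compC′ disjoint girth =
  𝒟 , valid simple deg∈2,3 , rooted simple , incidence neighbour
  where
  neighbour : ∀ v → ∃ (Adj H v)
  neighbour v = count>0⇒∃ (Graph.adj H v) (≤-trans (s≤s z≤n) (proj₁ minDeg v))
  simple : ∀ {u v} → u ≢ v → mult H u v ≤ 1
  simple = ¬C4⇒mult≤1 H (girth 4 (n≤1+n 3) (n≤1+n 5))
  deg∈2,3 : ∀ v → deg H v ≡ 2 ⊎ deg H v ≡ 3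
  deg∈2,3 v = 2≤m≤3⇒m≡2⊎m≡3 (proj₁ minDeg v) (maxDeg v)
  open NeighbourhoodDecomposition H
    (D2Components⇒bipartition H connected bipartite neighbour compC compC′ disjoint)
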